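{- For all positive integers $m,n,k$, let $a=2-(m \bmod 2)$ and $b=2-(n\bmod 2)$ (so $a=1$ if $m$ is odd and $a=2$ if $m$ is even, and similarly for $b$). Then $$\mathcal{G}\left(T_{\{m\}} \stackrel{k}{\cdot - \cdot} T_{\{n\}}\right)=\mathcal{G}\left(T_{\{a\}} \stackrel{k}{\cdot - \cdot} T_{\{b\}}\right).$$
   Context: Node-Kayles is the impartial game on a finite simple graph $G$ in which a move chooses a vertex $v$ and deletes its closed neighbourhood $N_G[v]$; the Grundy value is $\mathcal{G}(\emptyset)=0$, $\mathcal{G}(G)=\mathrm{mex}\{\mathcal{G}(G\setminus N_G[v]) : v\in V(G)\}$. For a positive integer $n$, $T_{\{n\}}$ is the star $K_{1,n}$ rooted at its center. For rooted graphs $G,H$ and $k\ge1$, the rooted grafting $G \stackrel{k}{\cdot - \cdot} H$ is obtained from disjoint copies of $G$ and $H$ and a path with $k+1$ vertices (length $k$) by identifying the root of $G$ with one endpoint of the path and the root of $H$ with the other endpoint. -}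

module Defs where

open import Data.Nat using (ℕ; zero; suc; _∸_; _+_)
open import Data.Nat.DivMod using (_%_)
open import Data.Bool using (Bool; true; false; _∧_; _∨_; not)
open import Data.Fin using (Fin; zero; suc; _↑ˡ_; _↑ʳ_)
open import Data.Fin.Properties using () renaming (_≟_ to _≟F_)
open import Data.List using (List; []; _∷_; map; filter; allFin; length; _++_; [_]; zip)
open import Data.Product using (_×_; _,_)
open import Data.Vec using (Vec; tabulate; lookup)
open import Relation.Nullary.Decidable using (does)

-- Adjacency is the symmetric closure of the list; loops
-- and repeated edges have no effect on closed neighbourhoods, so every
-- such value denotes a finite simple graph.

record Graph : Set where
  constructor graph
  field
    size  : ℕ
    edges : List (Fin size × Fin size)
open Graph public

record Rooted : Set where
  constructor rooted
  field
    gr   : Graph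
    root : Fin (size gr)
open Rooted public

_==_ : ∀ {n} → Fin n → Fin n → Bool
x == y = does (x ≟F y)

adjacent : (G : Graph) → Fin (size G) → Fin (size G) → Bool
adjacent G u v = go (edges G)
  where
  go : List (Fin (size G) × Fin (size G)) → Bool
  go []            = false
  go ((x , y) ∷ es) = ((x == u) ∧ (y == v)) ∨ ((x == v) ∧ (y == u)) ∨ go es

inClosedNbhd : (G : Graph) → Fin (size G) → Fin (size G) → Bool
inClosedNbhd G v u = (u == v) ∨ adjacent G u v

elemℕ : ℕ → List ℕ → Bool
elemℕ x []       = false
elemℕ x (y ∷ ys) = does (Data.Nat._≟_ x y) ∨ elemℕ x ys

mexFrom : ℕ → ℕ → List ℕ → ℕ
mexFrom zero     i xs = i
mexFrom (suc f)  i xs with elemℕ i xs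
... | true  = mexFrom f (suc i) xs
... | false = i

mex : List ℕ → ℕ
mex xs = mexFrom (suc (length xs)) 0 xs

-- positions: the set of remaining vertices (an induced subgraph of G)
Position : Graph → Set
Position G = Vec Bool (size G)

-- Grundy value of a position, with fuel.  Every move removes at least the
-- chosen vertex, so fuel ≥ (number of remaining vertices) suffices.
grundyF : (G : Graph) → ℕ → Position G → ℕ
grundyF G zero    S = 0
grundyF G (suc f) S =
  mex (map (λ v → grundyF G f (tabulate λ u → lookup S u ∧ not (inClosedNbhd G v u)))
           (filter (λ v → Data.Bool._≟_ (lookup S v) true) (allFin (size G))))

grundy : Graph → ℕ
grundy G = grundyF G (size G) (tabulate λ _ → true)

star : ℕ → Rooted
star n = rooted (graph (suc n) (map (λ i → (zero , suc i)) (allFin n))) zero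

-- Rooted grafting  G ·-k-· H  (intended for k ≥ 1).
-- Vertex set: V(G) ⊎ (k-1 internal path vertices) ⊎ V(H), encoded as
-- Fin (|G| + ((k ∸ 1) + |H|)).  The path is
--   root G , p₀ , … , p_{k-2} , root H
-- with k edges between consecutive vertices.

consecutive : ∀ {A : Set} → List A → List (A × A)
consecutive []           = []
consecutive (x ∷ [])     = []
consecutive (x ∷ y ∷ xs) = (x , y) ∷ consecutive (y ∷ xs)

graft : Rooted → ℕ → Rooted → Rooted
graft G k H = rooted (graph N es) (injG (root G))
  where
  nG = size (gr G)
  nH = size (gr H)
  N  = nG + ((k ∸ 1) + nH)
  injG : Fin nG → Fin N
  injG x = x ↑ˡ ((k ∸ 1) + nH)
  injP : Fin (k ∸ 1) → Fin N
  injP x = nG ↑ʳ (x ↑ˡ nH)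
  injH : Fin nH → Fin N
  injH x = nG ↑ʳ ((k ∸ 1) ↑ʳ x)
  pathVs : List (Fin N)
  pathVs = injG (root G) ∷ (map injP (allFin (k ∸ 1)) ++ [ injH (root H) ])
  es : List (Fin N × Fin N)
  es = map (λ { (x , y) → (injG x , injG y) }) (edges (gr G))
    ++ map (λ { (x , y) → (injH x , injH y) }) (edges (gr H))
    ++ consecutive pathVs

par : ℕ → ℕ
par m = 2 ∸ (m % 2)

-- Two isolated vertices can be deleted from a Node-Kayles position without changing its Grundy value:
-- either one answers a move at the other.  Consequently, if a vertex c carries three pendant vertices
-- l₁, l₂, l₃, deleting l₁ and l₂ preserves the Grundy value, by induction on the position: a move at
-- l₁ (or l₂) deletes c and isolates the other two leaves, so it has the value of the move at l₃ in
-- the smaller position; a move next to c isolates l₁ and l₂; every other move keeps the configuration.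
-- The graft with a star of m + 2 leaves minus two leaves is, as an induced subgraph, the graft with
-- a star of m leaves, so at either end the number of leaves only matters through its parity.

module Submission where

open import Defs
open import Data.Nat using (ℕ; zero; suc; _+_; _∸_; _≤_; _<_; z≤n)
open import Data.Nat.Properties
  using (<-cmp; n≮n; n≮0; ≤-refl; ≤-trans; <-≤-trans; ≤-pred; m≤n⇒m<n∨m≡n; m≤n⇒m≤1+n; n≤0⇒n≡0; ≮⇒≥;
         +-suc; +-identityʳ; +-comm)
open import Data.Nat.DivMod using (_%_; [m+n]%n≡m%n)
open import Data.Nat.Induction using (<-wellFounded)
open import Data.Bool using (Bool; true; false; _∧_; _∨_; not)
open import Data.Bool.Properties using (∨-zeroʳ)
open import Data.Fin using (Fin; zero; suc; toℕ; _↑ˡ_; _↑ʳ_; splitAt; join)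
open import Data.Fin.Patterns using (0F; 1F; 2F)
open import Data.Fin.Properties
  using (toℕ<n; toℕ-injective; pigeonhole; <⇒≢; suc-injective; ↑ˡ-injective; ↑ʳ-injective;
         splitAt-↑ˡ; splitAt-↑ʳ; splitAt⁻¹-↑ˡ; splitAt⁻¹-↑ʳ)
  renaming (_≟_ to _≟ᶠ_)
open import Data.Fin.Subset using (Subset; _∈_; _∉_; _⊆_; _─_; _-_; _∪_; ⁅_⁆; ⊤; ∣_∣)
open import Data.Fin.Subset.Properties
  using (_∈?_; ∈⊤; ⊆-antisym; p─q⊆p; x∈p∧x∉q⇒x∈p─q; p─q─r≡p─q∪r; p─q─r≡p─r─q; p─x─y≡p─y─x;
         x∈p∪q⁺; x∈p∪q⁻; x∈p∩q⁺; p∩q≢∅⇒∣p─q∣<∣p∣; ∣p∣≤n; x∈⁅x⁆; x∈⁅y⁆⇒x≡y; x≢y⇒x∉⁅y⁆; x∉⁅y⁆⇒x≢y)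
open import Data.List using (List; []; _∷_; _++_; [_]; length; lookup; map; filter; allFin)
open import Data.List.Properties using (map-cong; map-++; map-∘)
open import Data.List.Membership.Propositional using () renaming (_∈_ to _∈ₗ_; _∉_ to _∉ₗ_)
open import Data.List.Membership.Propositional.Properties
  using (∈-map⁺; ∈-map⁻; ∈-filter⁺; ∈-filter⁻; ∈-allFin; ∈-++⁺ˡ; ∈-++⁺ʳ; ∈-++⁻)
open import Data.List.Membership.DecPropositional Data.Nat._≟_ using () renaming (_∈?_ to _∈ₗ?_)
open import Data.List.Relation.Unary.Any using (here; there; index)
open import Data.List.Relation.Unary.Any.Properties using (lookup-index)
open import Data.Vec using (tabulate; _∷_) renaming (lookup to lookupᵥ)
open import Data.Vec.Properties using (lookup∘tabulate; []=⇒lookup; lookup⇒[]=)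
open import Data.Product using (_×_; _,_; ∃₂; ∃-syntax; proj₁; proj₂)
open import Data.Sum using (_⊎_; inj₁; inj₂; [_,_]′)
open import Function using (_∘_; id)
open import Function.Definitions using (Injective)
open import Induction.WellFounded using (Acc; acc)
open import Relation.Nullary using (¬_; Dec; yes; no; does; contradiction)
open import Relation.Binary using (tri<; tri≈; tri>)
open import Relation.Binary.PropositionalEquality hiding ([_])

-- Minimum excludant

elemℕ≡does-∈? : ∀ x xs → elemℕ x xs ≡ does (x ∈ₗ? xs)
elemℕ≡does-∈? x []       = refl
elemℕ≡does-∈? x (y ∷ ys) = cong (does (x Data.Nat.≟ y) ∨_) (elemℕ≡does-∈? x ys)

elemℕ-true⇒∈ : ∀ {x xs} → elemℕ x xs ≡ true → x ∈ₗ xs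
elemℕ-true⇒∈ {x} {xs} e with x ∈ₗ? xs | elemℕ≡does-∈? x xs
... | yes x∈xs | _  = x∈xs
... | no _     | eq = contradiction (trans (sym eq) e) λ ()

elemℕ-false⇒∉ : ∀ {x xs} → elemℕ x xs ≡ false → x ∉ₗ xs
elemℕ-false⇒∉ {x} {xs} e with x ∈ₗ? xs | elemℕ≡does-∈? x xs
... | yes _   | eq = contradiction (trans (sym eq) e) λ ()
... | no x∉xs | _  = x∉xs

mexFrom-below : ∀ f {i j} xs → i ≤ j → j < mexFrom f i xs → j ∈ₗ xs
mexFrom-below zero    xs i≤j j<i = contradiction (<-≤-trans j<i i≤j) (n≮n _)
mexFrom-below (suc f) {i} xs i≤j j<m with elemℕ i xs in eq
... | false = contradiction (<-≤-trans j<m i≤j) (n≮n _)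
... | true with m≤n⇒m<n∨m≡n i≤j
...   | inj₁ i<j  = mexFrom-below f xs i<j j<m
...   | inj₂ refl = elemℕ-true⇒∈ eq

mexFrom-∈ : ∀ f i xs → mexFrom f i xs ∈ₗ xs → mexFrom f i xs ≡ f + i
mexFrom-∈ zero    i xs _ = refl
mexFrom-∈ (suc f) i xs m∈xs with elemℕ i xs in eq
... | false = contradiction m∈xs (elemℕ-false⇒∉ eq)
... | true  = trans (mexFrom-∈ f (suc i) xs m∈xs) (+-suc f i)

¬range⊆ : ∀ xs → ¬ (∀ {j} → j < suc (length xs) → j ∈ₗ xs)
¬range⊆ xs below =
  let i , j , i<j , same = pigeonhole ≤-refl position
  in <⇒≢ i<j (toℕ-injective (begin
    toℕ i                  ≡⟨ lookup-index (below (toℕ<n i)) ⟩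
    lookup xs (position i) ≡⟨ cong (lookup xs) same ⟩
    lookup xs (position j) ≡⟨ lookup-index (below (toℕ<n j)) ⟨
    toℕ j                  ∎))
  where
  open ≡-Reasoning
  position : Fin (suc (length xs)) → Fin (length xs)
  position j = index (below (toℕ<n j))

mex-below : ∀ {j} xs → j < mex xs → j ∈ₗ xs
mex-below xs = mexFrom-below (suc (length xs)) xs z≤n

mex-∉ : ∀ xs → mex xs ∉ₗ xs
mex-∉ xs mex∈xs = ¬range⊆ xs λ j<1+len → mex-below xs (subst (_ <_) (sym exhausted) j<1+len)
  where
  exhausted : mex xs ≡ suc (length xs)
  exhausted = trans (mexFrom-∈ (suc (length xs)) 0 xs mex∈xs) (+-identityʳ _)

mex≡0 : ∀ {xs} → 0 ∉ₗ xs → mex xs ≡ 0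
mex≡0 {xs} 0∉xs = n≤0⇒n≡0 (≮⇒≥ (0∉xs ∘ mex-below xs))

mex-≡ : ∀ {xs ys} → (∀ {x} → x ∈ₗ ys → x ∈ₗ xs) → mex ys ∉ₗ xs → mex xs ≡ mex ys
mex-≡ {xs} {ys} ys⊆xs mex-ys∉xs with <-cmp (mex xs) (mex ys)
... | tri< lt _ _ = contradiction (ys⊆xs (mex-below ys lt)) (mex-∉ xs)
... | tri≈ _ eq _ = eq
... | tri> _ _ gt = contradiction (mex-below xs gt) mex-ys∉xs

mex-cong : ∀ {xs ys} → (∀ {x} → x ∈ₗ xs → x ∈ₗ ys) → (∀ {x} → x ∈ₗ ys → x ∈ₗ xs) → mex xs ≡ mex ys
mex-cong {ys = ys} xs⊆ys ys⊆xs = mex-≡ ys⊆xs (mex-∉ ys ∘ xs⊆ys)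

x∈p─q⇒x∉q : ∀ {n} {x : Fin n} (p q : Subset n) → x ∈ p ─ q → x ∉ q
x∈p─q⇒x∉q (_ ∷ p) (true  ∷ q) (Data.Vec.there x∈p─q) (Data.Vec.there x∈q) = x∈p─q⇒x∉q p q x∈p─q x∈q
x∈p─q⇒x∉q (_ ∷ p) (false ∷ q) (Data.Vec.there x∈p─q) (Data.Vec.there x∈q) = x∈p─q⇒x∉q p q x∈p─q x∈q

x∈p-y⇒x≢y : ∀ {n} {x y : Fin n} (p : Subset n) → x ∈ p - y → x ≢ y
x∈p-y⇒x≢y {y = y} p x∈p-y = x∉⁅y⁆⇒x≢y (x∈p─q⇒x∉q p ⁅ y ⁆ x∈p-y)

x∈p-y⇒x∈p : ∀ {n} {x y : Fin n} (p : Subset n) → x ∈ p - y → x ∈ p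
x∈p-y⇒x∈p {y = y} p = p─q⊆p p ⁅ y ⁆

x∈p∧x≢y⇒x∈p-y : ∀ {n} {x y : Fin n} {p : Subset n} → x ∈ p → x ≢ y → x ∈ p - y
x∈p∧x≢y⇒x∈p-y x∈p x≢y = x∈p∧x∉q⇒x∈p─q x∈p (x≢y⇒x∉⁅y⁆ x≢y)

x∉p⇒p-x≡p : ∀ {n} {x : Fin n} {p : Subset n} → x ∉ p → p - x ≡ p
x∉p⇒p-x≡p {x = x} {p} x∉p = ⊆-antisym (p─q⊆p p ⁅ x ⁆) λ y∈p → x∈p∧x≢y⇒x∈p-y y∈p λ { refl → x∉p y∈p }

─-cong-on : ∀ {n} {p q r : Subset n} → (∀ {x} → x ∈ p → x ∈ q → x ∈ r) → (∀ {x} → x ∈ p → x ∈ r → x ∈ q) →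
            p ─ q ≡ p ─ r
─-cong-on {p = p} {q} {r} q⊆r r⊆q = ⊆-antisym (one-way r⊆q) (one-way q⊆r)
  where
  one-way : ∀ {s t} → (∀ {x} → x ∈ p → x ∈ t → x ∈ s) → p ─ s ⊆ p ─ t
  one-way {s} {t} t⊆s x∈p─s = x∈p∧x∉q⇒x∈p─q (p─q⊆p p s x∈p─s) (x∈p─q⇒x∉q p s x∈p─s ∘ t⊆s (p─q⊆p p s x∈p─s))

∈-tabulate⁻ : ∀ {n} {x : Fin n} {f : Fin n → Bool} → x ∈ tabulate f → f x ≡ true
∈-tabulate⁻ {x = x} {f} x∈ = trans (sym (lookup∘tabulate f x)) ([]=⇒lookup x∈)

∈-tabulate⁺ : ∀ {n} {x : Fin n} {f : Fin n → Bool} → f x ≡ true → x ∈ tabulate f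
∈-tabulate⁺ {x = x} {f} fx = lookup⇒[]= _ _ (trans (lookup∘tabulate f x) fx)

tabulate-∧-not : ∀ {n} (p : Subset n) (f : Fin n → Bool) → tabulate (λ x → lookupᵥ p x ∧ not (f x)) ≡ p ─ tabulate f
tabulate-∧-not p f = ⊆-antisym lhs⊆rhs rhs⊆lhs
  where
  lhs⊆rhs : tabulate (λ x → lookupᵥ p x ∧ not (f x)) ⊆ p ─ tabulate f
  lhs⊆rhs {x} x∈ with lookupᵥ p x in px | f x in fx | ∈-tabulate⁻ x∈
  ... | true  | false | _ = x∈p∧x∉q⇒x∈p─q (lookup⇒[]= _ _ px) λ x∈f → contradiction (trans (sym (∈-tabulate⁻ x∈f)) fx) λ ()
  ... | true  | true  | ()
  ... | false | _     | ()
  rhs⊆lhs : p ─ tabulate f ⊆ tabulate (λ x → lookupᵥ p x ∧ not (f x))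
  rhs⊆lhs {x} x∈ with lookupᵥ p x in px | f x in fx
  ... | true  | false = ∈-tabulate⁺ (cong₂ (λ a b → a ∧ not b) px fx)
  ... | true  | true  = contradiction (∈-tabulate⁺ fx) (x∈p─q⇒x∉q p (tabulate f) x∈)
  ... | false | _     = contradiction (trans (sym px) ([]=⇒lookup (p─q⊆p p (tabulate f) x∈))) λ ()

-- Adjacency and closed neighbourhoods

∨-zeroʳ-under : ∀ a b {c} → c ≡ true → a ∨ b ∨ c ≡ true
∨-zeroʳ-under a b refl = trans (cong (a ∨_) (∨-zeroʳ b)) (∨-zeroʳ a)

==-refl : ∀ {n} (x : Fin n) → (x == x) ≡ true
==-refl x with x ≟ᶠ x
... | yes _   = refl
... | no x≢x = contradiction refl x≢x

N[_]_ : (G : Graph) → Fin (size G) → Subset (size G)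
N[ G ] v = tabulate (inClosedNbhd G v)

module _ (G : Graph) where

  Edge : Fin (size G) → Fin (size G) → Set
  Edge u v = (u , v) ∈ₗ edges G ⊎ (v , u) ∈ₗ edges G

  Edge-sym : ∀ {u v} → Edge u v → Edge v u
  Edge-sym (inj₁ uv) = inj₂ uv
  Edge-sym (inj₂ vu) = inj₁ vu

  -- `adjacent` scans the edge list with a `go` local to its where-block, which has no accessible
  -- name; the `_` below is solved to that `go` by unification with the `with`-abstracted equation.
  private mutual
    adjacentIn : Fin (size G) → Fin (size G) → List (Fin (size G) × Fin (size G)) → Bool
    adjacentIn u v = _

    adjacent≡adjacentIn : ∀ u v → adjacent G u v ≡ adjacentIn u v (edges G)
    adjacent≡adjacentIn u v with edges G
    ... | _ = refl

  adjacentIn⇒Edge : ∀ {u v} es → adjacentIn u v es ≡ true → (u , v) ∈ₗ es ⊎ (v , u) ∈ₗ es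
  adjacentIn⇒Edge {u} {v} ((x , y) ∷ es) adj with x ≟ᶠ u | y ≟ᶠ v | x ≟ᶠ v | y ≟ᶠ u
  ... | yes refl | yes refl | _        | _        = inj₁ (here refl)
  ... | _        | _        | yes refl | yes refl = inj₂ (here refl)
  ... | no _     | _        | no _     | _        = Data.Sum.map there there (adjacentIn⇒Edge es adj)
  ... | no _     | _        | yes _    | no _     = Data.Sum.map there there (adjacentIn⇒Edge es adj)
  ... | yes _    | no _     | no _     | _        = Data.Sum.map there there (adjacentIn⇒Edge es adj)
  ... | yes _    | no _     | yes _    | no _     = Data.Sum.map there there (adjacentIn⇒Edge es adj)

  Edge⇒adjacentIn : ∀ {u v} es → (u , v) ∈ₗ es ⊎ (v , u) ∈ₗ es → adjacentIn u v es ≡ true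
  Edge⇒adjacentIn {u = u} {v} (_ ∷ _) (inj₁ (here refl)) rewrite ==-refl u | ==-refl v = refl
  Edge⇒adjacentIn {u = u} {v} (_ ∷ _) (inj₂ (here refl)) rewrite ==-refl u | ==-refl v = ∨-zeroʳ _
  Edge⇒adjacentIn {u = u} {v} ((x , y) ∷ es) (inj₁ (there e)) =
    ∨-zeroʳ-under ((x == u) ∧ (y == v)) ((x == v) ∧ (y == u)) (Edge⇒adjacentIn es (inj₁ e))
  Edge⇒adjacentIn {u = u} {v} ((x , y) ∷ es) (inj₂ (there e)) =
    ∨-zeroʳ-under ((x == u) ∧ (y == v)) ((x == v) ∧ (y == u)) (Edge⇒adjacentIn es (inj₂ e))

  adjacent⇒Edge : ∀ {u v} → adjacent G u v ≡ true → Edge u v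
  adjacent⇒Edge {u} {v} adj = adjacentIn⇒Edge (edges G) (trans (sym (adjacent≡adjacentIn u v)) adj)

  Edge⇒adjacent : ∀ {u v} → Edge u v → adjacent G u v ≡ true
  Edge⇒adjacent {u} {v} e = trans (adjacent≡adjacentIn u v) (Edge⇒adjacentIn (edges G) e)

  ∈N⁻ : ∀ {u v} → u ∈ N[ G ] v → u ≡ v ⊎ Edge u v
  ∈N⁻ {u} {v} u∈N with u ≟ᶠ v | trans (sym (lookup∘tabulate (inClosedNbhd G v) u)) ([]=⇒lookup u∈N)
  ... | yes u≡v | _   = inj₁ u≡v
  ... | no _    | adj = inj₂ (adjacent⇒Edge adj)

  ∈N⁺ : ∀ {u v} → u ≡ v ⊎ Edge u v → u ∈ N[ G ] v
  ∈N⁺ {u} {v} u~v = lookup⇒[]= _ _ (trans (lookup∘tabulate (inClosedNbhd G v) u) (closed u~v))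
    where
    closed : u ≡ v ⊎ Edge u v → inClosedNbhd G v u ≡ true
    closed (inj₁ refl) = cong (_∨ adjacent G u u) (==-refl u)
    closed (inj₂ e)    = trans (cong ((u == v) ∨_) (Edge⇒adjacent e)) (∨-zeroʳ _)

  v∈N[v] : ∀ v → v ∈ N[ G ] v
  v∈N[v] v = ∈N⁺ (inj₁ refl)

  N-sym : ∀ {u v} → u ∈ N[ G ] v → v ∈ N[ G ] u
  N-sym u∈N with ∈N⁻ u∈N
  ... | inj₁ refl = u∈N
  ... | inj₂ e    = ∈N⁺ (inj₂ (Edge-sym e))

-- Grundy values of positions

module _ (G : Graph) where

  move≡ : ∀ (S : Position G) v → tabulate (λ u → lookupᵥ S u ∧ not (inClosedNbhd G v u)) ≡ S ─ N[ G ] v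
  move≡ S v = tabulate-∧-not S (inClosedNbhd G v)

  moves : Position G → List (Fin (size G))
  moves S = filter (λ v → lookupᵥ S v Data.Bool.≟ true) (allFin (size G))

  options : ℕ → Position G → List ℕ
  options f S = map (λ v → grundyF G f (S ─ N[ G ] v)) (moves S)

  grundyF-suc : ∀ f S → grundyF G (suc f) S ≡ mex (options f S)
  grundyF-suc f S = cong mex (map-cong (λ v → cong (grundyF G f) (move≡ S v)) (moves S))

  ∈-options⁺ : ∀ f {S v} → v ∈ S → grundyF G f (S ─ N[ G ] v) ∈ₗ options f S
  ∈-options⁺ f {S} v∈S = ∈-map⁺ _ (∈-filter⁺ (λ v → lookupᵥ S v Data.Bool.≟ true) (∈-allFin _) ([]=⇒lookup v∈S))

  ∈-options⁻ : ∀ f S {x} → x ∈ₗ options f S → ∃[ v ] v ∈ S × x ≡ grundyF G f (S ─ N[ G ] v)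
  ∈-options⁻ f S x∈ =
    let v , v∈filter , x≡ = ∈-map⁻ _ x∈
    in v , lookup⇒[]= _ _ (proj₂ (∈-filter⁻ (λ v → lookupᵥ S v Data.Bool.≟ true) {xs = allFin (size G)} v∈filter)) , x≡

  ∣move∣<∣S∣ : ∀ {S v} → v ∈ S → ∣ S ─ N[ G ] v ∣ < ∣ S ∣
  ∣move∣<∣S∣ {S} {v} v∈S = p∩q≢∅⇒∣p─q∣<∣p∣ S (N[ G ] v) (v , x∈p∩q⁺ (v∈S , v∈N[v] G v))

  grundyF-fuel : ∀ f f′ S → ∣ S ∣ ≤ f → ∣ S ∣ ≤ f′ → grundyF G f S ≡ grundyF G f′ S
  grundyF-fuel zero    zero     S _ _ = refl
  grundyF-fuel zero    (suc f′) S ∣S∣≤0 _ = sym (trans (grundyF-suc f′ S) (mex≡0 λ 0∈ →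
    let v , v∈S , _ = ∈-options⁻ f′ S 0∈ in n≮0 (≤-trans (∣move∣<∣S∣ v∈S) ∣S∣≤0)))
  grundyF-fuel (suc f) zero     S ∣S∣≤1+f ∣S∣≤0 = sym (grundyF-fuel zero (suc f) S ∣S∣≤0 ∣S∣≤1+f)
  grundyF-fuel (suc f) (suc f′) S ∣S∣≤1+f ∣S∣≤1+f′ = begin
    grundyF G (suc f) S    ≡⟨ grundyF-suc f S ⟩
    mex (options f S)      ≡⟨ mex-cong (transfer f f′ ∣S∣≤1+f ∣S∣≤1+f′) (transfer f′ f ∣S∣≤1+f′ ∣S∣≤1+f) ⟩
    mex (options f′ S)     ≡⟨ grundyF-suc f′ S ⟨
    grundyF G (suc f′) S   ∎
    where
    open ≡-Reasoning
    transfer : ∀ g g′ {x} → ∣ S ∣ ≤ suc g → ∣ S ∣ ≤ suc g′ → x ∈ₗ options g S → x ∈ₗ options g′ S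
    transfer g g′ ∣S∣≤1+g ∣S∣≤1+g′ x∈ =
      let v , v∈S , x≡ = ∈-options⁻ g S x∈
          ∣S─Nv∣<∣S∣ = ∣move∣<∣S∣ v∈S
          same-value = grundyF-fuel g g′ (S ─ N[ G ] v)
                         (≤-pred (≤-trans ∣S─Nv∣<∣S∣ ∣S∣≤1+g)) (≤-pred (≤-trans ∣S─Nv∣<∣S∣ ∣S∣≤1+g′))
      in subst (_∈ₗ options g′ S) (sym (trans x≡ same-value)) (∈-options⁺ g′ v∈S)

  -- One step more fuel than any position needs, so that 𝒢 S unfolds to a mex.
  𝒢 : Position G → ℕ
  𝒢 S = grundyF G (suc (size G)) S

  OptionValue : Position G → ℕ → Set
  OptionValue S x = ∃[ v ] v ∈ S × x ≡ 𝒢 (S ─ N[ G ] v)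

  grundyF-size≡𝒢 : ∀ S → grundyF G (size G) S ≡ 𝒢 S
  grundyF-size≡𝒢 S = grundyF-fuel (size G) (suc (size G)) S (∣p∣≤n S) (m≤n⇒m≤1+n (∣p∣≤n S))

  𝒢≡mex : ∀ S → 𝒢 S ≡ mex (options (size G) S)
  𝒢≡mex = grundyF-suc (size G)

  ∈-options⇒OptionValue : ∀ {S x} → x ∈ₗ options (size G) S → OptionValue S x
  ∈-options⇒OptionValue {S} x∈ =
    let v , v∈S , x≡ = ∈-options⁻ (size G) S x∈ in v , v∈S , trans x≡ (grundyF-size≡𝒢 _)

  OptionValue⇒∈-options : ∀ {S x} → OptionValue S x → x ∈ₗ options (size G) S
  OptionValue⇒∈-options {S} (v , v∈S , refl) =
    subst (_∈ₗ options (size G) S) (grundyF-size≡𝒢 _) (∈-options⁺ (size G) v∈S)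

  𝒢-∉ : ∀ S → ¬ OptionValue S (𝒢 S)
  𝒢-∉ S opt = mex-∉ (options (size G) S) (subst (_∈ₗ options (size G) S) (𝒢≡mex S) (OptionValue⇒∈-options opt))

  grundy≡𝒢⊤ : grundy G ≡ 𝒢 ⊤
  grundy≡𝒢⊤ = trans (cong (grundyF G (size G)) (all-true≡⊤ (size G))) (grundyF-size≡𝒢 ⊤)
    where
    all-true≡⊤ : ∀ n → tabulate {n = n} (λ _ → true) ≡ ⊤
    all-true≡⊤ zero    = refl
    all-true≡⊤ (suc n) = cong (true ∷_) (all-true≡⊤ n)

𝒢-≡ : ∀ G H {S T} → (∀ {x} → OptionValue H T x → OptionValue G S x) → ¬ OptionValue G S (𝒢 H T) → 𝒢 G S ≡ 𝒢 H T
𝒢-≡ G H {S} {T} T⊆S 𝒢T∉S = begin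
  𝒢 G S                      ≡⟨ 𝒢≡mex G S ⟩
  mex (options G (size G) S) ≡⟨ mex-≡ (OptionValue⇒∈-options G ∘ T⊆S ∘ ∈-options⇒OptionValue H) 𝒢T∉S′ ⟩
  mex (options H (size H) T) ≡⟨ 𝒢≡mex H T ⟨
  𝒢 H T                      ∎
  where
  open ≡-Reasoning
  𝒢T∉S′ : mex (options H (size H) T) ∉ₗ options G (size G) S
  𝒢T∉S′ = 𝒢T∉S ∘ ∈-options⇒OptionValue G ∘ subst (_∈ₗ options G (size G) S) (sym (𝒢≡mex H T))

𝒢-cong : ∀ G H {S T} → (∀ {x} → OptionValue G S x → OptionValue H T x) → (∀ {x} → OptionValue H T x → OptionValue G S x) →
         𝒢 G S ≡ 𝒢 H T
𝒢-cong G H {S} {T} S⊆T T⊆S = 𝒢-≡ G H T⊆S (𝒢-∉ H T ∘ S⊆T)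

-- Isolated and pendant vertices

module _ (G : Graph) where

  Isolated : Position G → Fin (size G) → Set
  Isolated S i = ∀ {u} → u ∈ S → u ∈ N[ G ] i → u ≡ i

  Isolated-⊆ : ∀ {S T i} → T ⊆ S → Isolated S i → Isolated T i
  Isolated-⊆ T⊆S iso u∈T = iso (T⊆S u∈T)

  move-isolated : ∀ {S i} → Isolated S i → S ─ N[ G ] i ≡ S - i
  move-isolated {S} {i} iso = ─-cong-on
    (λ u∈S u∈Ni → subst (_∈ ⁅ i ⁆) (sym (iso u∈S u∈Ni)) (x∈⁅x⁆ i))
    (λ _ u∈⁅i⁆ → subst (_∈ N[ G ] i) (sym (x∈⁅y⁆⇒x≡y i u∈⁅i⁆)) (v∈N[v] G i))

  isolated-survives : ∀ {S i v} → Isolated S i → i ∈ S → v ∈ S → v ≢ i → i ∈ S ─ N[ G ] v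
  isolated-survives iso i∈S v∈S v≢i = x∈p∧x∉q⇒x∈p─q i∈S (v≢i ∘ iso v∈S ∘ N-sym G)

  move-remove-comm : ∀ S i v → S - i ─ N[ G ] v ≡ S ─ N[ G ] v - i
  move-remove-comm S i v = p─q─r≡p─r─q S ⁅ i ⁆ (N[ G ] v)

  move-remove₂-comm : ∀ S i j v → S - i - j ─ N[ G ] v ≡ S ─ N[ G ] v - i - j
  move-remove₂-comm S i j v = trans (move-remove-comm (S - i) j v) (cong (_- j) (move-remove-comm S i v))

  ∈-remove₂⁻ : ∀ {S : Position G} {i j v} → v ∈ S - i - j → v ∈ S × v ≢ i × v ≢ j
  ∈-remove₂⁻ {S} {i} v∈ = x∈p-y⇒x∈p S (x∈p-y⇒x∈p (S - i) v∈) , x∈p-y⇒x≢y S (x∈p-y⇒x∈p (S - i) v∈) , x∈p-y⇒x≢y (S - i) v∈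

  ∈-remove₂⁺ : ∀ {S : Position G} {i j v} → v ∈ S → v ≢ i → v ≢ j → v ∈ S - i - j
  ∈-remove₂⁺ v∈S v≢i v≢j = x∈p∧x≢y⇒x∈p-y (x∈p∧x≢y⇒x∈p-y v∈S v≢i) v≢j

  𝒢-remove≢𝒢-remove₂ : ∀ {S a b} → Isolated S b → b ∈ S → b ≢ a → 𝒢 G (S - a) ≢ 𝒢 G (S - a - b)
  𝒢-remove≢𝒢-remove₂ {S} {a} {b} iso-b b∈S b≢a same = 𝒢-∉ G (S - a)
    (b , x∈p∧x≢y⇒x∈p-y b∈S b≢a , trans same (cong (𝒢 G) (sym (move-isolated (Isolated-⊆ (p─q⊆p S ⁅ a ⁆) iso-b)))))

  𝒢-remove-isolated-pair : ∀ {S i j} → i ≢ j → Isolated S i → Isolated S j → i ∈ S → j ∈ S → 𝒢 G S ≡ 𝒢 G (S - i - j)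
  𝒢-remove-isolated-pair {S} {i} {j} i≢j = go (<-wellFounded ∣ S ∣)
    where
    go : ∀ {S} → Acc _<_ ∣ S ∣ → Isolated S i → Isolated S j → i ∈ S → j ∈ S → 𝒢 G S ≡ 𝒢 G (S - i - j)
    go {S} (acc rec) iso-i iso-j i∈S j∈S = 𝒢-≡ G G S′-options⊆ 𝒢S′∉
      where
      open ≡-Reasoning
      S′ = S - i - j
      step : ∀ {v} → v ∈ S → v ≢ i → v ≢ j → 𝒢 G (S ─ N[ G ] v) ≡ 𝒢 G (S′ ─ N[ G ] v)
      step {v} v∈S v≢i v≢j = trans
        (go (rec (∣move∣<∣S∣ G v∈S)) (Isolated-⊆ (p─q⊆p S _) iso-i) (Isolated-⊆ (p─q⊆p S _) iso-j)
            (isolated-survives iso-i i∈S v∈S v≢i) (isolated-survives iso-j j∈S v∈S v≢j))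
        (sym (cong (𝒢 G) (move-remove₂-comm S i j v)))
      S′-options⊆ : ∀ {x} → OptionValue G S′ x → OptionValue G S x
      S′-options⊆ (v , v∈S′ , refl) = let v∈S , v≢i , v≢j = ∈-remove₂⁻ v∈S′ in v , v∈S , sym (step v∈S v≢i v≢j)
      𝒢S′∉ : ¬ OptionValue G S (𝒢 G S′)
      𝒢S′∉ (v , v∈S , eq) with v ≟ᶠ i | v ≟ᶠ j
      ... | yes refl | _        = 𝒢-remove≢𝒢-remove₂ iso-j j∈S (i≢j ∘ sym)
                                    (sym (trans eq (cong (𝒢 G) (move-isolated iso-i))))
      ... | no _     | yes refl = 𝒢-remove≢𝒢-remove₂ iso-i i∈S i≢j (begin
        𝒢 G (S - j)            ≡⟨ cong (𝒢 G) (move-isolated iso-j) ⟨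
        𝒢 G (S ─ N[ G ] j)     ≡⟨ eq ⟨
        𝒢 G (S - i - j)        ≡⟨ cong (𝒢 G) (p─x─y≡p─y─x S i j) ⟩
        𝒢 G (S - j - i)        ∎)
      ... | no v≢i   | no v≢j   = 𝒢-∉ G S′ (v , ∈-remove₂⁺ v∈S v≢i v≢j , trans eq (step v∈S v≢i v≢j))

  record Pendant (l c : Fin (size G)) : Set where
    field
      l≢c      : l ≢ c
      attached : Edge G l c
      unique   : ∀ {u} → Edge G u l → u ≡ c

  c∈N[l] : ∀ {l c} → Pendant l c → c ∈ N[ G ] l
  c∈N[l] p = ∈N⁺ G (inj₂ (Edge-sym G (Pendant.attached p)))

  ∈N[l]⁻ : ∀ {l c u} → Pendant l c → u ∈ N[ G ] l → u ≡ l ⊎ u ≡ c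
  ∈N[l]⁻ p u∈Nl = Data.Sum.map₂ (Pendant.unique p) (∈N⁻ G u∈Nl)

  move-pendant : ∀ S {l c} → Pendant l c → S ─ N[ G ] l ≡ S - l - c
  move-pendant S {l} {c} p = trans (─-cong-on N⊆ ⊆N) (sym (p─q─r≡p─q∪r S ⁅ l ⁆ ⁅ c ⁆))
    where
    N⊆ : ∀ {u} → u ∈ S → u ∈ N[ G ] l → u ∈ ⁅ l ⁆ ∪ ⁅ c ⁆
    N⊆ _ u∈Nl with ∈N[l]⁻ p u∈Nl
    ... | inj₁ refl = x∈p∪q⁺ (inj₁ (x∈⁅x⁆ l))
    ... | inj₂ refl = x∈p∪q⁺ (inj₂ (x∈⁅x⁆ c))
    ⊆N : ∀ {u} → u ∈ S → u ∈ ⁅ l ⁆ ∪ ⁅ c ⁆ → u ∈ N[ G ] l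
    ⊆N _ u∈ with x∈p∪q⁻ ⁅ l ⁆ ⁅ c ⁆ u∈
    ... | inj₁ u∈⁅l⁆ = subst (_∈ N[ G ] l) (sym (x∈⁅y⁆⇒x≡y l u∈⁅l⁆)) (v∈N[v] G l)
    ... | inj₂ u∈⁅c⁆ = subst (_∈ N[ G ] l) (sym (x∈⁅y⁆⇒x≡y c u∈⁅c⁆)) (c∈N[l] p)

  pendant-isolated : ∀ {S l c} → Pendant l c → c ∉ S → Isolated S l
  pendant-isolated p c∉S u∈S u∈Nl with ∈N[l]⁻ p u∈Nl
  ... | inj₁ u≡l  = u≡l
  ... | inj₂ refl = contradiction u∈S c∉S

  pendant-survives : ∀ {S l c v} → Pendant l c → l ∈ S → v ≢ l → v ≢ c → l ∈ S ─ N[ G ] v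
  pendant-survives p l∈S v≢l v≢c = x∈p∧x∉q⇒x∈p─q l∈S λ l∈Nv → [ v≢l , v≢c ]′ (∈N[l]⁻ p (N-sym G l∈Nv))

  move-remove-neighbour : ∀ S {i v} → i ∈ N[ G ] v → S - i ─ N[ G ] v ≡ S ─ N[ G ] v
  move-remove-neighbour S {i} {v} i∈Nv =
    trans (move-remove-comm S i v) (x∉p⇒p-x≡p λ i∈ → x∈p─q⇒x∉q S (N[ G ] v) i∈ i∈Nv)

  move-remove₂-neighbours : ∀ S {i j v} → i ∈ N[ G ] v → j ∈ N[ G ] v → S - i - j ─ N[ G ] v ≡ S ─ N[ G ] v
  move-remove₂-neighbours S {i} i∈Nv j∈Nv = trans (move-remove-neighbour (S - i) j∈Nv) (move-remove-neighbour S i∈Nv)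

  𝒢-move-pendant-swap : ∀ {S a b c l} → Pendant a c → Pendant b c → Pendant l c → b ≢ a → l ≢ a → b ≢ l → b ∈ S → l ∈ S →
                        𝒢 G (S ─ N[ G ] a) ≡ 𝒢 G (S - a - b ─ N[ G ] l)
  𝒢-move-pendant-swap {S} {a} {b} {c} {l} pa pb pl b≢a l≢a b≢l b∈S l∈S = begin
    𝒢 G (S ─ N[ G ] a)          ≡⟨ cong (𝒢 G) (move-pendant S pa) ⟩
    𝒢 G (S - a - c)             ≡⟨ 𝒢-remove-isolated-pair b≢l (pendant-isolated pb c∉) (pendant-isolated pl c∉)
                                     (∈-remove₂⁺ b∈S b≢a (Pendant.l≢c pb)) (∈-remove₂⁺ l∈S l≢a (Pendant.l≢c pl)) ⟩
    𝒢 G (S - a - c - b - l)     ≡⟨ cong (λ T → 𝒢 G (T - l)) (p─x─y≡p─y─x (S - a) c b) ⟩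
    𝒢 G (S - a - b - c - l)     ≡⟨ cong (𝒢 G) (p─x─y≡p─y─x (S - a - b) c l) ⟩
    𝒢 G (S - a - b - l - c)     ≡⟨ cong (𝒢 G) (move-pendant (S - a - b) pl) ⟨
    𝒢 G (S - a - b ─ N[ G ] l)  ∎
    where
    open ≡-Reasoning
    c∉ : c ∉ S - a - c
    c∉ c∈ = x∈p-y⇒x≢y (S - a) c∈ refl

  𝒢-remove-pendant-pair : ∀ {S c l₁ l₂ l₃} → Pendant l₁ c → Pendant l₂ c → Pendant l₃ c →
                          l₁ ≢ l₂ → l₁ ≢ l₃ → l₂ ≢ l₃ → c ∈ S → l₁ ∈ S → l₂ ∈ S → l₃ ∈ S →
                          𝒢 G S ≡ 𝒢 G (S - l₁ - l₂)
  𝒢-remove-pendant-pair {S} {c} {l₁} {l₂} {l₃} p₁ p₂ p₃ l₁≢l₂ l₁≢l₃ l₂≢l₃ = go (<-wellFounded ∣ S ∣)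
    where
    open Pendant using (l≢c)
    go : ∀ {S} → Acc _<_ ∣ S ∣ → c ∈ S → l₁ ∈ S → l₂ ∈ S → l₃ ∈ S → 𝒢 G S ≡ 𝒢 G (S - l₁ - l₂)
    go {S} (acc rec) c∈S l₁∈S l₂∈S l₃∈S = 𝒢-cong G G S-options⊆ S′-options⊆
      where
      S′ = S - l₁ - l₂
      c-option : 𝒢 G (S ─ N[ G ] c) ≡ 𝒢 G (S′ ─ N[ G ] c)
      c-option = cong (𝒢 G) (sym (move-remove₂-neighbours S (N-sym G (c∈N[l] p₁)) (N-sym G (c∈N[l] p₂))))
      l₃∈S′ = ∈-remove₂⁺ l₃∈S (l₁≢l₃ ∘ sym) (l₂≢l₃ ∘ sym)

      step : ∀ {v} → v ∈ S → v ≢ c → v ≢ l₁ → v ≢ l₂ → 𝒢 G (S ─ N[ G ] v) ≡ 𝒢 G (S′ ─ N[ G ] v)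
      step {v} v∈S v≢c v≢l₁ v≢l₂ = trans (by-cases (c ∈? N[ G ] v)) (sym (cong (𝒢 G) (move-remove₂-comm S l₁ l₂ v)))
        where
        l₁-survives = pendant-survives p₁ l₁∈S v≢l₁ v≢c
        l₂-survives = pendant-survives p₂ l₂∈S v≢l₂ v≢c
        by-cases : Dec (c ∈ N[ G ] v) → 𝒢 G (S ─ N[ G ] v) ≡ 𝒢 G (S ─ N[ G ] v - l₁ - l₂)
        by-cases (yes c∈Nv) =
          𝒢-remove-isolated-pair l₁≢l₂ (pendant-isolated p₁ c∉) (pendant-isolated p₂ c∉) l₁-survives l₂-survives
          where c∉ = λ c∈ → x∈p─q⇒x∉q S (N[ G ] v) c∈ c∈Nv
        by-cases (no c∉Nv) = go (rec (∣move∣<∣S∣ G v∈S)) (x∈p∧x∉q⇒x∈p─q c∈S c∉Nv) l₁-survives l₂-survives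
          (pendant-survives p₃ l₃∈S (λ { refl → c∉Nv (c∈N[l] p₃) }) v≢c)

      S-options⊆ : ∀ {x} → OptionValue G S x → OptionValue G S′ x
      S-options⊆ (v , v∈S , refl) with v ≟ᶠ c | v ≟ᶠ l₁ | v ≟ᶠ l₂
      ... | yes refl | _        | _        = c , ∈-remove₂⁺ c∈S (l≢c p₁ ∘ sym) (l≢c p₂ ∘ sym) , c-option
      ... | no _     | yes refl | _        =
        l₃ , l₃∈S′ , 𝒢-move-pendant-swap p₁ p₂ p₃ (l₁≢l₂ ∘ sym) (l₁≢l₃ ∘ sym) l₂≢l₃ l₂∈S l₃∈S
      ... | no _     | no _     | yes refl =
        l₃ , l₃∈S′ , trans (𝒢-move-pendant-swap p₂ p₁ p₃ l₁≢l₂ (l₂≢l₃ ∘ sym) l₁≢l₃ l₁∈S l₃∈S)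
                           (cong (λ T → 𝒢 G (T ─ N[ G ] l₃)) (p─x─y≡p─y─x S l₂ l₁))
      ... | no v≢c   | no v≢l₁  | no v≢l₂  = v , ∈-remove₂⁺ v∈S v≢l₁ v≢l₂ , step v∈S v≢c v≢l₁ v≢l₂

      S′-options⊆ : ∀ {x} → OptionValue G S′ x → OptionValue G S x
      S′-options⊆ (v , v∈S′ , refl) with ∈-remove₂⁻ v∈S′ | v ≟ᶠ c
      ... | _ , _ , _           | yes refl = c , c∈S , sym c-option
      ... | v∈S , v≢l₁ , v≢l₂ | no v≢c   = v , v∈S , sym (step v∈S v≢c v≢l₁ v≢l₂)

-- Induced embeddings

record Embedding (A B : Graph) : Set where
  field
    to        : Fin (size A) → Fin (size B)
    injective : Injective _≡_ _≡_ to
    edge⁺     : ∀ {x y} → (x , y) ∈ₗ edges A → (to x , to y) ∈ₗ edges B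
    edge⁻     : ∀ {x y} → (to x , to y) ∈ₗ edges B → (x , y) ∈ₗ edges A

module _ {A B : Graph} (e : Embedding A B) where
  open Embedding e

  to∈N⁺ : ∀ {x y} → y ∈ N[ A ] x → to y ∈ N[ B ] (to x)
  to∈N⁺ y∈Nx = ∈N⁺ B (Data.Sum.map (cong to) (Data.Sum.map edge⁺ edge⁺) (∈N⁻ A y∈Nx))

  to∈N⁻ : ∀ {x y} → to y ∈ N[ B ] (to x) → y ∈ N[ A ] x
  to∈N⁻ y∈Nx = ∈N⁺ A (Data.Sum.map injective (Data.Sum.map edge⁻ edge⁻) (∈N⁻ B y∈Nx))

  record IsImage (S : Position A) (T : Position B) : Set where
    field
      to-∈    : ∀ {x} → x ∈ S → to x ∈ T
      from-∈  : ∀ {x} → to x ∈ T → x ∈ S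
      covered : ∀ {w} → w ∈ T → ∃[ x ] to x ≡ w

  IsImage-move : ∀ {S T v} → IsImage S T → IsImage (S ─ N[ A ] v) (T ─ N[ B ] (to v))
  IsImage-move {S} {T} {v} img = record
    { to-∈    = λ x∈ → x∈p∧x∉q⇒x∈p─q (to-∈ (p─q⊆p S _ x∈)) (x∈p─q⇒x∉q S _ x∈ ∘ to∈N⁻)
    ; from-∈  = λ x∈ → x∈p∧x∉q⇒x∈p─q (from-∈ (p─q⊆p T _ x∈)) (x∈p─q⇒x∉q T _ x∈ ∘ to∈N⁺)
    ; covered = covered ∘ p─q⊆p T _
    }
    where open IsImage img

  𝒢-image : ∀ {S T} → IsImage S T → 𝒢 A S ≡ 𝒢 B T
  𝒢-image {S} = go (<-wellFounded ∣ S ∣)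
    where
    go : ∀ {S T} → Acc _<_ ∣ S ∣ → IsImage S T → 𝒢 A S ≡ 𝒢 B T
    go {S} {T} (acc rec) img = 𝒢-cong A B S⊆T T⊆S
      where
      open IsImage img
      same : ∀ {v} → v ∈ S → 𝒢 A (S ─ N[ A ] v) ≡ 𝒢 B (T ─ N[ B ] (to v))
      same v∈S = go (rec (∣move∣<∣S∣ A v∈S)) (IsImage-move img)
      S⊆T : ∀ {x} → OptionValue A S x → OptionValue B T x
      S⊆T (v , v∈S , refl) = to v , to-∈ v∈S , same v∈S
      T⊆S : ∀ {x} → OptionValue B T x → OptionValue A S x
      T⊆S (w , w∈T , refl) with covered w∈T
      ... | v , refl = v , from-∈ w∈T , sym (same (from-∈ w∈T))

grundy-remove-pendant-pair : ∀ {A B} (e : Embedding A B) {c l₁ l₂ l₃} →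
  Pendant B l₁ c → Pendant B l₂ c → Pendant B l₃ c → l₁ ≢ l₂ → l₁ ≢ l₃ → l₂ ≢ l₃ →
  (∀ x → Embedding.to e x ≢ l₁) → (∀ x → Embedding.to e x ≢ l₂) →
  (∀ w → w ≢ l₁ → w ≢ l₂ → ∃[ x ] Embedding.to e x ≡ w) →
  grundy B ≡ grundy A
grundy-remove-pendant-pair {A} {B} e {c} {l₁} {l₂} {l₃} p₁ p₂ p₃ l₁≢l₂ l₁≢l₃ l₂≢l₃ misses₁ misses₂ covers = begin
  grundy B          ≡⟨ grundy≡𝒢⊤ B ⟩
  𝒢 B ⊤             ≡⟨ 𝒢-remove-pendant-pair B p₁ p₂ p₃ l₁≢l₂ l₁≢l₃ l₂≢l₃ ∈⊤ ∈⊤ ∈⊤ ∈⊤ ⟩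
  𝒢 B (⊤ - l₁ - l₂) ≡⟨ 𝒢-image e image ⟨
  𝒢 A ⊤             ≡⟨ grundy≡𝒢⊤ A ⟨
  grundy A          ∎
  where
  open ≡-Reasoning
  image : IsImage e ⊤ (⊤ - l₁ - l₂)
  image = record
    { to-∈    = λ {x} _ → ∈-remove₂⁺ B ∈⊤ (misses₁ x) (misses₂ x)
    ; from-∈  = λ _ → ∈⊤
    ; covered = λ {w} w∈ → let _ , w≢l₁ , w≢l₂ = ∈-remove₂⁻ B w∈ in covers w w≢l₁ w≢l₂
    }

-- Grafting

↑ˡ≢↑ʳ : ∀ {m n} (x : Fin m) (y : Fin n) → x ↑ˡ n ≢ m ↑ʳ y
↑ˡ≢↑ʳ zero    _ ()
↑ˡ≢↑ʳ (suc x) y eq = ↑ˡ≢↑ʳ x y (suc-injective eq)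

↑-view : ∀ m {n} (z : Fin (m + n)) → (∃[ x ] x ↑ˡ n ≡ z) ⊎ (∃[ y ] m ↑ʳ y ≡ z)
↑-view m z with splitAt m z in eq
... | inj₁ x = inj₁ (x , splitAt⁻¹-↑ˡ eq)
... | inj₂ y = inj₂ (y , splitAt⁻¹-↑ʳ eq)

_⊕_ : ∀ {a a′ b b′} → (Fin a → Fin a′) → (Fin b → Fin b′) → Fin (a + b) → Fin (a′ + b′)
_⊕_ {a} {a′} {b} {b′} f g z = join a′ b′ (Data.Sum.map f g (splitAt a z))

module _ {a a′ b b′} (f : Fin a → Fin a′) (g : Fin b → Fin b′) where

  ⊕-↑ˡ : ∀ x → (f ⊕ g) (x ↑ˡ b) ≡ f x ↑ˡ b′
  ⊕-↑ˡ x rewrite splitAt-↑ˡ a x b = refl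

  ⊕-↑ʳ : ∀ y → (f ⊕ g) (a ↑ʳ y) ≡ a′ ↑ʳ g y
  ⊕-↑ʳ y rewrite splitAt-↑ʳ a b y = refl

  ⊕-↑ˡ⁻ : ∀ {z w} → (f ⊕ g) z ≡ w ↑ˡ b′ → ∃[ x ] x ↑ˡ b ≡ z × f x ≡ w
  ⊕-↑ˡ⁻ {z} eq with ↑-view a z
  ... | inj₁ (x , refl) = x , refl , ↑ˡ-injective b′ _ _ (trans (sym (⊕-↑ˡ x)) eq)
  ... | inj₂ (y , refl) = contradiction (trans (sym eq) (⊕-↑ʳ y)) (↑ˡ≢↑ʳ _ _)

  ⊕-↑ʳ⁻ : ∀ {z w} → (f ⊕ g) z ≡ a′ ↑ʳ w → ∃[ y ] a ↑ʳ y ≡ z × g y ≡ w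
  ⊕-↑ʳ⁻ {z} eq with ↑-view a z
  ... | inj₁ (x , refl) = contradiction (trans (sym (⊕-↑ˡ x)) eq) (↑ˡ≢↑ʳ _ _)
  ... | inj₂ (y , refl) = y , refl , ↑ʳ-injective a′ _ _ (trans (sym (⊕-↑ʳ y)) eq)

  ⊕-injective : Injective _≡_ _≡_ f → Injective _≡_ _≡_ g → Injective _≡_ _≡_ (f ⊕ g)
  ⊕-injective f-inj g-inj {z₁} {z₂} eq with ↑-view a z₂
  ... | inj₁ (x , refl) = let x′ , z₁≡ , fx′≡ = ⊕-↑ˡ⁻ (trans eq (⊕-↑ˡ x)) in trans (sym z₁≡) (cong (_↑ˡ b) (f-inj fx′≡))
  ... | inj₂ (y , refl) = let y′ , z₁≡ , gy′≡ = ⊕-↑ʳ⁻ (trans eq (⊕-↑ʳ y)) in trans (sym z₁≡) (cong (a ↑ʳ_) (g-inj gy′≡))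

both : ∀ {A B : Set} → (A → B) → A × A → B × B
both f = Data.Product.map f f

consecutive-map : ∀ {A B : Set} (f : A → B) xs → consecutive (map f xs) ≡ map (both f) (consecutive xs)
consecutive-map f []           = refl
consecutive-map f (_ ∷ [])     = refl
consecutive-map f (x ∷ y ∷ xs) = cong ((f x , f y) ∷_) (consecutive-map f (y ∷ xs))

∈-consecutive⁻ : ∀ {A : Set} {x y : A} xs → (x , y) ∈ₗ consecutive xs → x ∈ₗ xs × y ∈ₗ xs
∈-consecutive⁻ (_ ∷ _ ∷ _)  (here refl) = here refl , there (here refl)
∈-consecutive⁻ (_ ∷ y ∷ xs) (there xy∈) = Data.Product.map there there (∈-consecutive⁻ (y ∷ xs) xy∈)

module Grafting (G : Rooted) (k : ℕ) (H : Rooted) where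

  nG nH P : ℕ
  nG = size (gr G)
  nH = size (gr H)
  P  = k ∸ 1

  Graft : Graph
  Graft = gr (graft G k H)

  inG : Fin nG → Fin (size Graft)
  inG x = x ↑ˡ (P + nH)

  inP : Fin P → Fin (size Graft)
  inP p = nG ↑ʳ (p ↑ˡ nH)

  inH : Fin nH → Fin (size Graft)
  inH y = nG ↑ʳ (P ↑ʳ y)

  path : List (Fin (size Graft))
  path = inG (root G) ∷ map inP (allFin P) ++ [ inH (root H) ]

  inG-injective : Injective _≡_ _≡_ inG
  inG-injective eq = ↑ˡ-injective _ _ _ eq

  inH-injective : Injective _≡_ _≡_ inH
  inH-injective eq = ↑ʳ-injective P _ _ (↑ʳ-injective nG _ _ eq)

  inG∈path : ∀ {a} → inG a ∈ₗ path → a ≡ root G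
  inG∈path (here eq) = inG-injective eq
  inG∈path (there a∈) with ∈-++⁻ (map inP (allFin P)) a∈
  ... | inj₁ a∈inP = let _ , _ , eq = ∈-map⁻ inP a∈inP in contradiction eq (↑ˡ≢↑ʳ _ _)
  ... | inj₂ (here eq) = contradiction eq (↑ˡ≢↑ʳ _ _)

  inH∈path : ∀ {b} → inH b ∈ₗ path → b ≡ root H
  inH∈path (here eq) = contradiction (sym eq) (↑ˡ≢↑ʳ _ _)
  inH∈path (there b∈) with ∈-++⁻ (map inP (allFin P)) b∈
  ... | inj₁ b∈inP = let _ , _ , eq = ∈-map⁻ inP b∈inP in contradiction (sym (↑ʳ-injective nG _ _ eq)) (↑ˡ≢↑ʳ _ _)
  ... | inj₂ (here eq) = inH-injective eq

  ∈-edges⁻ : ∀ {x y} → (x , y) ∈ₗ edges Graft →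
               (∃₂ λ a b → (a , b) ∈ₗ edges (gr G) × inG a ≡ x × inG b ≡ y)
             ⊎ (∃₂ λ a b → (a , b) ∈ₗ edges (gr H) × inH a ≡ x × inH b ≡ y)
             ⊎ (x , y) ∈ₗ consecutive path
  ∈-edges⁻ xy∈ with ∈-++⁻ (map (both inG) (edges (gr G))) xy∈
  ... | inj₁ xy∈G with ∈-map⁻ (both inG) xy∈G
  ...   | (a , b) , ab∈ , refl = inj₁ (a , b , ab∈ , refl , refl)
  ∈-edges⁻ xy∈ | inj₂ xy∈rest with ∈-++⁻ (map (both inH) (edges (gr H))) xy∈rest
  ... | inj₁ xy∈H with ∈-map⁻ (both inH) xy∈H
  ...   | (a , b) , ab∈ , refl = inj₂ (inj₁ (a , b , ab∈ , refl , refl))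
  ∈-edges⁻ xy∈ | inj₂ xy∈rest | inj₂ xy∈path = inj₂ (inj₂ xy∈path)

  ∈-edges-G⁺ : ∀ {a b} → (a , b) ∈ₗ edges (gr G) → (inG a , inG b) ∈ₗ edges Graft
  ∈-edges-G⁺ ab∈ = ∈-++⁺ˡ (∈-map⁺ (both inG) ab∈)

  ∈-edges-H⁺ : ∀ {a b} → (a , b) ∈ₗ edges (gr H) → (inH a , inH b) ∈ₗ edges Graft
  ∈-edges-H⁺ ab∈ = ∈-++⁺ʳ (map (both inG) (edges (gr G))) (∈-++⁺ˡ (∈-map⁺ (both inH) ab∈))

  ∈-edges-path⁺ : ∀ {e} → e ∈ₗ consecutive path → e ∈ₗ edges Graft
  ∈-edges-path⁺ e∈ = ∈-++⁺ʳ (map (both inG) (edges (gr G))) (∈-++⁺ʳ (map (both inH) (edges (gr H))) e∈)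

  Edge-at-inG : ∀ {l u} → l ≢ root G → Edge Graft u (inG l) → ∃[ a ] inG a ≡ u × Edge (gr G) a l
  Edge-at-inG l≢root (inj₁ ul∈) with ∈-edges⁻ ul∈
  ... | inj₁ (a , b , ab∈ , refl , eq)     = a , refl , inj₁ (subst (λ b → (a , b) ∈ₗ _) (inG-injective eq) ab∈)
  ... | inj₂ (inj₁ (_ , _ , _ , _ , eq))   = contradiction (sym eq) (↑ˡ≢↑ʳ _ _)
  ... | inj₂ (inj₂ ul∈path)                = contradiction (inG∈path (proj₂ (∈-consecutive⁻ path ul∈path))) l≢root
  Edge-at-inG l≢root (inj₂ lu∈) with ∈-edges⁻ lu∈
  ... | inj₁ (a , b , ab∈ , eq , refl)     = b , refl , inj₂ (subst (λ a → (a , b) ∈ₗ _) (inG-injective eq) ab∈)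
  ... | inj₂ (inj₁ (_ , _ , _ , eq , _))   = contradiction (sym eq) (↑ˡ≢↑ʳ _ _)
  ... | inj₂ (inj₂ lu∈path)                = contradiction (inG∈path (proj₁ (∈-consecutive⁻ path lu∈path))) l≢root

  Edge-at-inH : ∀ {l u} → l ≢ root H → Edge Graft u (inH l) → ∃[ a ] inH a ≡ u × Edge (gr H) a l
  Edge-at-inH l≢root (inj₁ ul∈) with ∈-edges⁻ ul∈
  ... | inj₁ (_ , _ , _ , _ , eq)          = contradiction eq (↑ˡ≢↑ʳ _ _)
  ... | inj₂ (inj₁ (a , b , ab∈ , refl , eq)) = a , refl , inj₁ (subst (λ b → (a , b) ∈ₗ _) (inH-injective eq) ab∈)
  ... | inj₂ (inj₂ ul∈path)                = contradiction (inH∈path (proj₂ (∈-consecutive⁻ path ul∈path))) l≢root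
  Edge-at-inH l≢root (inj₂ lu∈) with ∈-edges⁻ lu∈
  ... | inj₁ (_ , _ , _ , eq , _)          = contradiction eq (↑ˡ≢↑ʳ _ _)
  ... | inj₂ (inj₁ (a , b , ab∈ , eq , refl)) = b , refl , inj₂ (subst (λ a → (a , b) ∈ₗ _) (inH-injective eq) ab∈)
  ... | inj₂ (inj₂ lu∈path)                = contradiction (inH∈path (proj₁ (∈-consecutive⁻ path lu∈path))) l≢root

  pendant-inG : ∀ {l c} → Pendant (gr G) l c → l ≢ root G → Pendant Graft (inG l) (inG c)
  pendant-inG p l≢root = record
    { l≢c      = Pendant.l≢c p ∘ inG-injective
    ; attached = Data.Sum.map ∈-edges-G⁺ ∈-edges-G⁺ (Pendant.attached p)
    ; unique   = λ e → let a , a↦u , a~l = Edge-at-inG l≢root e in trans (sym a↦u) (cong inG (Pendant.unique p a~l))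
    }

  pendant-inH : ∀ {l c} → Pendant (gr H) l c → l ≢ root H → Pendant Graft (inH l) (inH c)
  pendant-inH p l≢root = record
    { l≢c      = Pendant.l≢c p ∘ inH-injective
    ; attached = Data.Sum.map ∈-edges-H⁺ ∈-edges-H⁺ (Pendant.attached p)
    ; unique   = λ e → let a , a↦u , a~l = Edge-at-inH l≢root e in trans (sym a↦u) (cong inH (Pendant.unique p a~l))
    }

record RootedEmbedding (G H : Rooted) : Set where
  field
    embedding : Embedding (gr G) (gr H)
    to-root   : Embedding.to embedding (root G) ≡ root H

module GraftEmbedding {G G′ H H′ : Rooted} (φ : RootedEmbedding G G′) (χ : RootedEmbedding H H′) (k : ℕ) where
  private
    module φ = Embedding (RootedEmbedding.embedding φ)
    module χ = Embedding (RootedEmbedding.embedding χ)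
    module S = Grafting G k H
    module B = Grafting G′ k H′

  Φ : Fin (size S.Graft) → Fin (size B.Graft)
  Φ = φ.to ⊕ (id ⊕ χ.to)

  Φ-inG : ∀ x → Φ (S.inG x) ≡ B.inG (φ.to x)
  Φ-inG = ⊕-↑ˡ φ.to (id ⊕ χ.to)

  Φ-inP : ∀ p → Φ (S.inP p) ≡ B.inP p
  Φ-inP p = trans (⊕-↑ʳ φ.to (id ⊕ χ.to) _) (cong (B.nG ↑ʳ_) (⊕-↑ˡ id χ.to p))

  Φ-inH : ∀ y → Φ (S.inH y) ≡ B.inH (χ.to y)
  Φ-inH y = trans (⊕-↑ʳ φ.to (id ⊕ χ.to) _) (cong (B.nG ↑ʳ_) (⊕-↑ʳ id χ.to y))

  Φ-inG⁻ : ∀ {z a} → Φ z ≡ B.inG a → ∃[ x ] S.inG x ≡ z × φ.to x ≡ a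
  Φ-inG⁻ = ⊕-↑ˡ⁻ φ.to (id ⊕ χ.to)

  Φ-inH⁻ : ∀ {z b} → Φ z ≡ B.inH b → ∃[ y ] S.inH y ≡ z × χ.to y ≡ b
  Φ-inH⁻ eq =
    let r , nG↑r≡z , r↦ = ⊕-↑ʳ⁻ φ.to (id ⊕ χ.to) eq
        y , P↑y≡r , χy≡b = ⊕-↑ʳ⁻ id χ.to r↦
    in y , trans (cong (S.nG ↑ʳ_) P↑y≡r) nG↑r≡z , χy≡b

  Φ-injective : Injective _≡_ _≡_ Φ
  Φ-injective = ⊕-injective φ.to (id ⊕ χ.to) φ.injective (⊕-injective id χ.to id χ.injective)

  Φ-path : map Φ S.path ≡ B.path
  Φ-path = cong₂ _∷_ (trans (Φ-inG _) (cong B.inG (RootedEmbedding.to-root φ)))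
    (trans (map-++ Φ (map S.inP (allFin S.P)) _)
           (cong₂ _++_ (trans (sym (map-∘ (allFin S.P))) (map-cong Φ-inP (allFin S.P)))
                       (cong [_] (trans (Φ-inH _) (cong B.inH (RootedEmbedding.to-root χ))))))

  consecutive-path : consecutive B.path ≡ map (both Φ) (consecutive S.path)
  consecutive-path = trans (cong consecutive (sym Φ-path)) (consecutive-map Φ S.path)

  path-edge⁺ : ∀ {e} → e ∈ₗ consecutive S.path → both Φ e ∈ₗ consecutive B.path
  path-edge⁺ {e} e∈ = subst (both Φ e ∈ₗ_) (sym consecutive-path) (∈-map⁺ (both Φ) e∈)

  path-edge⁻ : ∀ {x y} → (Φ x , Φ y) ∈ₗ consecutive B.path → (x , y) ∈ₗ consecutive S.path
  path-edge⁻ {x} {y} xy∈ with ∈-map⁻ (both Φ) (subst ((Φ x , Φ y) ∈ₗ_) consecutive-path xy∈)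
  ... | (x′ , y′) , xy′∈ , eq = subst₂ (λ u v → (u , v) ∈ₗ consecutive S.path)
                                  (Φ-injective (sym (cong proj₁ eq))) (Φ-injective (sym (cong proj₂ eq))) xy′∈

  edge⁺ : ∀ {x y} → (x , y) ∈ₗ edges S.Graft → (Φ x , Φ y) ∈ₗ edges B.Graft
  edge⁺ xy∈ with S.∈-edges⁻ xy∈
  ... | inj₁ (a , b , ab∈ , refl , refl) =
    subst₂ (λ u v → (u , v) ∈ₗ edges B.Graft) (sym (Φ-inG a)) (sym (Φ-inG b)) (B.∈-edges-G⁺ (φ.edge⁺ ab∈))
  ... | inj₂ (inj₁ (a , b , ab∈ , refl , refl)) =
    subst₂ (λ u v → (u , v) ∈ₗ edges B.Graft) (sym (Φ-inH a)) (sym (Φ-inH b)) (B.∈-edges-H⁺ (χ.edge⁺ ab∈))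
  ... | inj₂ (inj₂ xy∈path) = B.∈-edges-path⁺ (path-edge⁺ xy∈path)

  edge⁻ : ∀ {x y} → (Φ x , Φ y) ∈ₗ edges B.Graft → (x , y) ∈ₗ edges S.Graft
  edge⁻ xy∈ with B.∈-edges⁻ xy∈
  ... | inj₁ (_ , _ , ab∈ , Φx , Φy) with Φ-inG⁻ (sym Φx) | Φ-inG⁻ (sym Φy)
  ...   | _ , refl , refl | _ , refl , refl = S.∈-edges-G⁺ (φ.edge⁻ ab∈)
  edge⁻ xy∈ | inj₂ (inj₁ (_ , _ , ab∈ , Φx , Φy)) with Φ-inH⁻ (sym Φx) | Φ-inH⁻ (sym Φy)
  ...   | _ , refl , refl | _ , refl , refl = S.∈-edges-H⁺ (χ.edge⁻ ab∈)
  edge⁻ xy∈ | inj₂ (inj₂ xy∈path) = S.∈-edges-path⁺ (path-edge⁻ xy∈path)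

  graft-embedding : Embedding S.Graft B.Graft
  graft-embedding = record { to = Φ ; injective = Φ-injective ; edge⁺ = edge⁺ ; edge⁻ = edge⁻ }

  Φ-covers : ∀ w → (∀ a → B.inG a ≡ w → ∃[ x ] φ.to x ≡ a) → (∀ b → B.inH b ≡ w → ∃[ y ] χ.to y ≡ b) → ∃[ z ] Φ z ≡ w
  Φ-covers w G′-covered H′-covered with ↑-view B.nG w
  ... | inj₁ (a , refl) = let x , φx≡a = G′-covered a refl in S.inG x , trans (Φ-inG x) (cong B.inG φx≡a)
  ... | inj₂ (r , refl) with ↑-view S.P r
  ...   | inj₁ (p , refl) = S.inP p , Φ-inP p
  ...   | inj₂ (b , refl) = let y , χy≡b = H′-covered b refl in S.inH y , trans (Φ-inH y) (cong B.inH χy≡b)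

  Φ-misses-inG : ∀ {a} → (∀ x → φ.to x ≢ a) → ∀ z → Φ z ≢ B.inG a
  Φ-misses-inG φ-misses z eq = let x , _ , φx≡a = Φ-inG⁻ eq in φ-misses x φx≡a

  Φ-misses-inH : ∀ {b} → (∀ y → χ.to y ≢ b) → ∀ z → Φ z ≢ B.inH b
  Φ-misses-inH χ-misses z eq = let y , _ , χy≡b = Φ-inH⁻ eq in χ-misses y χy≡b

-- Stars

star-edge⁺ : ∀ {m} (i : Fin m) → (zero , suc i) ∈ₗ edges (gr (star m))
star-edge⁺ i = ∈-map⁺ _ (∈-allFin i)

star-edge⁻ : ∀ {m x y} → (x , y) ∈ₗ edges (gr (star m)) → x ≡ zero × ∃[ i ] y ≡ suc i
star-edge⁻ xy∈ with ∈-map⁻ _ xy∈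
... | i , _ , refl = refl , i , refl

star-pendant : ∀ {m} (i : Fin m) → Pendant (gr (star m)) (suc i) zero
star-pendant i = record
  { l≢c      = λ ()
  ; attached = inj₂ (star-edge⁺ i)
  ; unique   = λ { (inj₁ ul∈) → proj₁ (star-edge⁻ ul∈) ; (inj₂ lu∈) → contradiction (proj₁ (star-edge⁻ lu∈)) λ () }
  }

skip₂ : ∀ {m} → Fin (suc m) → Fin (3 + m)
skip₂ zero    = zero
skip₂ (suc i) = suc (suc (suc i))

skip₂-injective : ∀ {m} → Injective _≡_ _≡_ (skip₂ {m})
skip₂-injective {x = zero}  {zero}  _    = refl
skip₂-injective {x = suc _} {suc _} refl = refl

skip₂≢1 : ∀ {m} (x : Fin (suc m)) → skip₂ x ≢ suc zero
skip₂≢1 zero    ()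
skip₂≢1 (suc _) ()

skip₂≢2 : ∀ {m} (x : Fin (suc m)) → skip₂ x ≢ suc (suc zero)
skip₂≢2 zero    ()
skip₂≢2 (suc _) ()

skip₂-covers : ∀ {m} (w : Fin (3 + m)) → w ≢ suc zero → w ≢ suc (suc zero) → ∃[ x ] skip₂ x ≡ w
skip₂-covers zero                _   _   = zero , refl
skip₂-covers (suc zero)          w≢1 _   = contradiction refl w≢1
skip₂-covers (suc (suc zero))    _   w≢2 = contradiction refl w≢2
skip₂-covers (suc (suc (suc i))) _   _   = suc i , refl

star-embedding : ∀ m → RootedEmbedding (star m) (star (2 + m))
star-embedding m = record
  { embedding = record { to = skip₂ ; injective = skip₂-injective ; edge⁺ = edge⁺ ; edge⁻ = edge⁻ }
  ; to-root   = refl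
  }
  where
  edge⁺ : ∀ {x y} → (x , y) ∈ₗ edges (gr (star m)) → (skip₂ x , skip₂ y) ∈ₗ edges (gr (star (2 + m)))
  edge⁺ xy∈ with star-edge⁻ xy∈
  ... | refl , i , refl = star-edge⁺ (suc (suc i))
  edge⁻ : ∀ {x y} → (skip₂ x , skip₂ y) ∈ₗ edges (gr (star (2 + m))) → (x , y) ∈ₗ edges (gr (star m))
  edge⁻ {zero}  {suc i} _   = star-edge⁺ i
  edge⁻ {zero}  {zero}  xy∈ = contradiction (proj₂ (proj₂ (star-edge⁻ xy∈))) λ ()
  edge⁻ {suc _} {_}     xy∈ = contradiction (proj₁ (star-edge⁻ xy∈)) λ ()

id-embedding : ∀ G → RootedEmbedding G G
id-embedding G = record
  { embedding = record { to = id ; injective = id ; edge⁺ = id ; edge⁻ = id }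
  ; to-root   = refl
  }

grundy-graft-star-left-minus-two : ∀ m k H → grundy (gr (graft (star (3 + m)) k H)) ≡ grundy (gr (graft (star (1 + m)) k H))
grundy-graft-star-left-minus-two m k H =
  grundy-remove-pendant-pair graft-embedding (leaf 0F) (leaf 1F) (leaf 2F) (distinct λ ()) (distinct λ ()) (distinct λ ())
    (Φ-misses-inG skip₂≢1) (Φ-misses-inG skip₂≢2) covers
  where
  open GraftEmbedding (star-embedding (suc m)) (id-embedding H) k
  module B = Grafting (star (3 + m)) k H
  leaf : ∀ i → Pendant B.Graft (B.inG (suc i)) (B.inG zero)
  leaf i = B.pendant-inG (star-pendant i) λ ()
  distinct : ∀ {i j} → i ≢ j → B.inG (suc i) ≢ B.inG (suc j)
  distinct i≢j = i≢j ∘ suc-injective ∘ B.inG-injective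
  covers : ∀ w → w ≢ B.inG 1F → w ≢ B.inG 2F → ∃[ z ] Φ z ≡ w
  covers w w≢l₁ w≢l₂ = Φ-covers w
    (λ a a↦w → skip₂-covers a (λ { refl → w≢l₁ (sym a↦w) }) (λ { refl → w≢l₂ (sym a↦w) }))
    (λ b _ → b , refl)

grundy-graft-star-right-minus-two : ∀ G k m → grundy (gr (graft G k (star (3 + m)))) ≡ grundy (gr (graft G k (star (1 + m))))
grundy-graft-star-right-minus-two G k m =
  grundy-remove-pendant-pair graft-embedding (leaf 0F) (leaf 1F) (leaf 2F) (distinct λ ()) (distinct λ ()) (distinct λ ())
    (Φ-misses-inH skip₂≢1) (Φ-misses-inH skip₂≢2) covers
  where
  open GraftEmbedding (id-embedding G) (star-embedding (suc m)) k
  module B = Grafting G k (star (3 + m))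
  leaf : ∀ i → Pendant B.Graft (B.inH (suc i)) (B.inH zero)
  leaf i = B.pendant-inH (star-pendant i) λ ()
  distinct : ∀ {i j} → i ≢ j → B.inH (suc i) ≢ B.inH (suc j)
  distinct i≢j = i≢j ∘ suc-injective ∘ B.inH-injective
  covers : ∀ w → w ≢ B.inH 1F → w ≢ B.inH 2F → ∃[ z ] Φ z ≡ w
  covers w w≢l₁ w≢l₂ = Φ-covers w
    (λ a _ → a , refl)
    (λ b b↦w → skip₂-covers b (λ { refl → w≢l₁ (sym b↦w) }) (λ { refl → w≢l₂ (sym b↦w) }))

par-suc-suc : ∀ m → par (2 + m) ≡ par m
par-suc-suc m = cong (2 ∸_) (trans (cong (_% 2) (+-comm 2 m)) ([m+n]%n≡m%n m 2))

grundy-graft-star-left-par : ∀ m k H → grundy (gr (graft (star (suc m)) k H)) ≡ grundy (gr (graft (star (par (suc m))) k H))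
grundy-graft-star-left-par zero          k H = refl
grundy-graft-star-left-par (suc zero)    k H = refl
grundy-graft-star-left-par (suc (suc m)) k H = begin
  grundy (gr (graft (star (3 + m)) k H))       ≡⟨ grundy-graft-star-left-minus-two m k H ⟩
  grundy (gr (graft (star (1 + m)) k H))       ≡⟨ grundy-graft-star-left-par m k H ⟩
  grundy (gr (graft (star (par (1 + m))) k H)) ≡⟨ cong (λ a → grundy (gr (graft (star a) k H))) (par-suc-suc (1 + m)) ⟨
  grundy (gr (graft (star (par (3 + m))) k H)) ∎
  where open ≡-Reasoning

grundy-graft-star-right-par : ∀ G k n → grundy (gr (graft G k (star (suc n)))) ≡ grundy (gr (graft G k (star (par (suc n)))))
grundy-graft-star-right-par G k zero          = refl
grundy-graft-star-right-par G k (suc zero)    = refl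
grundy-graft-star-right-par G k (suc (suc n)) = begin
  grundy (gr (graft G k (star (3 + n))))       ≡⟨ grundy-graft-star-right-minus-two G k n ⟩
  grundy (gr (graft G k (star (1 + n))))       ≡⟨ grundy-graft-star-right-par G k n ⟩
  grundy (gr (graft G k (star (par (1 + n))))) ≡⟨ cong (λ b → grundy (gr (graft G k (star b)))) (par-suc-suc (1 + n)) ⟨
  grundy (gr (graft G k (star (par (3 + n))))) ∎
  where open ≡-Reasoning

-- The reductions hold for every path length.
mainTheorem7 : (m n k : ℕ) → 0 < m → 0 < n → 0 < k →
    grundy (gr (graft (star m) k (star n))) ≡ grundy (gr (graft (star (par m)) k (star (par n))))
mainTheorem7 (suc m) (suc n) k _ _ _ =
  trans (grundy-graft-star-left-par m k (star (suc n))) (grundy-graft-star-right-par (star (par (suc m))) k n)
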